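{- Let $p$ be an odd prime, $\zeta_p$ a primitive $p$th root of unity, $K=\mathbb{Q}(\zeta_p+\zeta_p^{ -1})$ with ring of integers $\mathcal{O}_K=\mathbb{Z}[\zeta_p+\zeta_p^{ -1}]$, and for $1\le j\le (p-1)/2$ let $\theta_j=\zeta_p^j+\zeta_p^{ -j}$. Then for every integer $m \geq 1$ and every $1 \leq j \leq (p-1)/2$, \[ \theta_j^{2^{(p-1)m}} \equiv \theta_j + 2 \pmod{4 \mathcal{O}_K}.\] -}

module Defs where

open import Data.Nat as ℕ using (ℕ; zero; suc; NonZero; _∸_)
open import Data.Nat.DivMod using (_mod_)
open import Data.Fin using (Fin; toℕ; _≟_)
open import Data.Integer as ℤ using (ℤ; +_)
open import Data.List using (List; []; _∷_; foldr; map; allFin)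
open import Data.Bool using (if_then_else_)
open import Data.Product using (∃)
open import Relation.Nullary.Decidable using (does)
open import Relation.Binary.PropositionalEquality using (_≡_)

-- Model of ℤ[ζ_p]:  ℤ[ζ_p] ≅ ℤ[x]/(Φ_p) = ℤ[C_p] / (1 + x + ... + x^(p-1)).
-- An element is a coefficient vector a : Fin p → ℤ standing for Σ_i a_i ζ^i;
-- two vectors represent the same element iff they differ by a constant
-- vector (integer multiple of 1 + ζ + ... + ζ^(p-1) = 0).
Cyc : ℕ → Set
Cyc p = Fin p → ℤ

sumℤ : List ℤ → ℤ
sumℤ = foldr ℤ._+_ (+ 0)

module _ {p : ℕ} .{{_ : NonZero p}} where

  _≈_ : Cyc p → Cyc p → Set
  a ≈ b = ∃ λ (c : ℤ) → ∀ k → a k ≡ b k ℤ.+ c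

  _⊕_ : Cyc p → Cyc p → Cyc p
  (a ⊕ b) k = a k ℤ.+ b k

  _⊛_ : Cyc p → Cyc p → Cyc p
  (a ⊛ b) k = sumℤ (map (λ i → a i ℤ.* b ((toℕ k ℕ.+ (p ∸ toℕ i)) mod p)) (allFin p))

  scale : ℤ → Cyc p → Cyc p
  scale c a k = c ℤ.* a k

  zeroᶜ : Cyc p
  zeroᶜ _ = + 0

module _ (p : ℕ) .{{_ : NonZero p}} where

  ζ^ : ℕ → Cyc p
  ζ^ n k = if does (k ≟ (n mod p)) then + 1 else + 0

  oneᶜ : Cyc p
  oneᶜ = ζ^ 0

  θ : ℕ → Cyc p
  θ j = ζ^ j ⊕ ζ^ (p ∸ j)

  _^ᶜ_ : Cyc p → ℕ → Cyc p
  a ^ᶜ zero = oneᶜ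
  a ^ᶜ suc n = a ⊛ (a ^ᶜ n)

  evalPoly : List ℤ → Cyc p → Cyc p
  evalPoly [] x = zeroᶜ
  evalPoly (c ∷ cs) x = scale c oneᶜ ⊕ (x ⊛ evalPoly cs x)

  -- a ≡ b (mod 4 O_K), O_K = ℤ[ζ_p + ζ_p⁻¹] = { f(θ_1) : f ∈ ℤ[X] }
  CongMod4OK : Cyc p → Cyc p → Set
  CongMod4OK a b = ∃ λ (cs : List ℤ) → a ≈ (b ⊕ scale (+ 4) (evalPoly cs (θ 1)))

module Submission where

-- We work in the group ring ℤ[C_p], which maps onto ℤ[ζ_p], and even obtain the
-- congruence coefficientwise there. Multiplication by θ_c = ζ^c + ζ^(-c) is a sum of two
-- shifts, whence θ_a θ_b = θ_(a+b) + θ_(a-b) and θ_0 = 2. So θ_c² = θ_(2c) + 2, and all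
-- θ_c lie in 𝒪 = ℤ[θ₁] by the recursion θ₁ θ_(n+1) = θ_(n+2) + θ_n. If x ≡ θ_c + 2
-- (mod 4𝒪) then x² ≡ (θ_c + 2)² ≡ θ_c² = θ_(2c) + 2, so θ_j^(2^N) ≡ θ_(2^N j) + 2 for
-- N ≥ 1. For N = (p-1)m Fermat's little theorem gives 2^N j ≡ j (mod p), hence
-- θ_(2^N j) = θ_j. Fermat for base 2 follows from 2^p = Σ_k C(p,k), as p divides
-- C(p,k) for 0 < k < p.

open import Defs
open import Data.Nat.Base using (ℕ)

module Fermat where

  open import Data.Nat.Base
  open import Data.Nat.Properties
  open import Data.Nat.Combinatorics
  open import Data.Nat.Divisibility
  open import Data.Nat.DivMod using (m/n*n≡m)
  open import Data.Nat.Primality using (Prime; euclidsLemma; prime⇒nonTrivial)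
  open import Data.Fin.Base using (Fin; zero; suc; toℕ; inject₁; fromℕ)
  open import Data.Fin.Properties using (toℕ-inject₁; toℕ-fromℕ; toℕ<n)
  open import Data.Sum.Base using (inj₁; inj₂)
  open import Function.Base using (_∘_)
  open import Relation.Binary.PropositionalEquality
  open import Relation.Nullary.Negation using (¬_; contradiction)
  import Algebra.Properties.CommutativeSemiring.Binomial +-*-commutativeSemiring as Binomial
  import Algebra.Properties.Semiring.Exp +-*-semiring as Semiring
  open import Algebra.Definitions.RawMonoid +-0-rawMonoid using (_×_)
  open import Algebra.Properties.Monoid.Sum +-0-monoid using (sum-cong-≗; sum-init-last; sum-syntax; sum⁺-syntax)

  semiring-^≡^ : ∀ x n → x Semiring.^ n ≡ x ^ n
  semiring-^≡^ x zero    = refl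
  semiring-^≡^ x (suc n) = cong (x *_) (semiring-^≡^ x n)

  m×1≡m : ∀ m → m × 1 ≡ m
  m×1≡m zero    = refl
  m×1≡m (suc m) = cong suc (m×1≡m m)

  2^n≡∑nCk : ∀ n → 2 ^ n ≡ ∑[ k ≤ n ] (n C toℕ k)
  2^n≡∑nCk n = begin
    2 ^ n                            ≡⟨ semiring-^≡^ 2 n ⟨
    2 Semiring.^ n                   ≡⟨ Binomial.theorem n 1 1 ⟩
    Binomial.binomialExpansion 1 1 n ≡⟨ sum-cong-≗ term≡C ⟩
    ∑[ k ≤ n ] (n C toℕ k)           ∎
    where
    open ≡-Reasoning
    1^m≡1 : ∀ m → 1 Semiring.^ m ≡ 1
    1^m≡1 m = trans (semiring-^≡^ 1 m) (^-zeroˡ m)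
    term≡C : ∀ k → Binomial.binomialTerm 1 1 n k ≡ n C toℕ k
    term≡C k = trans (cong ((n C toℕ k) ×_) (cong₂ _*_ (1^m≡1 (toℕ k)) (1^m≡1 (n ∸ toℕ k)))) (m×1≡m (n C toℕ k))

  prime∤n! : ∀ {p n} → Prime p → n < p → ¬ p ∣ n !
  prime∤n! {n = zero}  pr _ p∣1 = nonTrivial⇒≢1 {{prime⇒nonTrivial pr}} (∣1⇒≡1 p∣1)
  prime∤n! {n = suc n} pr n<p p∣n! with euclidsLemma (suc n) (n !) pr p∣n!
  ... | inj₁ p∣1+n = <⇒≱ n<p (∣⇒≤ p∣1+n)
  ... | inj₂ p∣n!  = prime∤n! pr (<-trans (n<1+n n) n<p) p∣n!

  nCk*k![n-k]!≡n! : ∀ {n k} → k ≤ n → (n C k) * (k ! * (n ∸ k) !) ≡ n !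
  nCk*k![n-k]!≡n! {n} {k} k≤n =
    trans (cong (_* (k ! * (n ∸ k) !)) (nCk≡n!/k![n-k]! k≤n)) (m/n*n≡m {{k !* (n ∸ k) !≢0}} (k![n∸k]!∣n! k≤n))

  prime∣pCk : ∀ {p k} → Prime p → 0 < k → k < p → p ∣ p C k
  prime∣pCk {p@(suc q)} {k} pr 0<k k<p
    with euclidsLemma (p C k) (k ! * (p ∸ k) !) pr (subst (p ∣_) (sym (nCk*k![n-k]!≡n! (<⇒≤ k<p))) (m∣m*n (q !)))
  ... | inj₁ p∣C = p∣C
  ... | inj₂ p∣k![p-k]! with euclidsLemma (k !) ((p ∸ k) !) pr p∣k![p-k]!
  ...   | inj₁ p∣k! = contradiction p∣k! (prime∤n! pr k<p)
  ...   | inj₂ p∣[p-k]! = contradiction p∣[p-k]! (prime∤n! pr (∸-monoʳ-< 0<k (<⇒≤ k<p)))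

  ∣-∑ : ∀ {d n} (f : Fin n → ℕ) → (∀ i → d ∣ f i) → d ∣ ∑[ i < n ] f i
  ∣-∑ {n = zero}  f d∣f = _ ∣0
  ∣-∑ {n = suc n} f d∣f = ∣m∣n⇒∣m+n (d∣f zero) (∣-∑ (f ∘ suc) (d∣f ∘ suc))

  prime∣2*[2^[p-1]∸1] : ∀ {p} → Prime p → p ∣ 2 * (2 ^ (p ∸ 1) ∸ 1)
  prime∣2*[2^[p-1]∸1] {p@(suc q)} pr = subst (p ∣_) (sym 2*[2^q∸1]≡D) p∣D
    where
    g : Fin q → ℕ
    g k = p C suc (toℕ (inject₁ k))
    D : ℕ
    D = ∑[ k < q ] g k
    p∣D : p ∣ D
    p∣D = ∣-∑ g (λ k → prime∣pCk pr (s≤s z≤n) (s≤s (subst (_< q) (sym (toℕ-inject₁ k)) (toℕ<n k))))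
    2^p≡2+D : 2 ^ p ≡ 2 + D
    2^p≡2+D = begin
      2 ^ p                              ≡⟨ 2^n≡∑nCk p ⟩
      1 + ∑[ k < p ] (p C suc (toℕ k))   ≡⟨ cong (1 +_) (sum-init-last {q} (λ k → p C suc (toℕ k))) ⟩
      1 + (D + p C suc (toℕ (fromℕ q)))  ≡⟨ cong (λ x → 1 + (D + p C suc x)) (toℕ-fromℕ q) ⟩
      1 + (D + p C p)                    ≡⟨ cong (λ x → 1 + (D + x)) (nCn≡1 p) ⟩
      1 + (D + 1)                        ≡⟨ cong suc (+-comm D 1) ⟩
      2 + D                              ∎
      where open ≡-Reasoning
    2*[2^q∸1]≡D : 2 * (2 ^ q ∸ 1) ≡ D
    2*[2^q∸1]≡D = trans (*-distribˡ-∸ 2 (2 ^ q) 1) (trans (cong (_∸ 2) 2^p≡2+D) (m+n∸m≡n 2 D))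

  fermat₂ : ∀ {p} → Prime p → p ≢ 2 → p ∣ 2 ^ (p ∸ 1) ∸ 1
  fermat₂ {p} pr p≢2 with euclidsLemma 2 (2 ^ (p ∸ 1) ∸ 1) pr (prime∣2*[2^[p-1]∸1] pr)
  ... | inj₂ p∣2^[p-1]∸1 = p∣2^[p-1]∸1
  ... | inj₁ p∣2         = contradiction (≤-antisym (∣⇒≤ p∣2) (nonTrivial⇒n>1 p {{prime⇒nonTrivial pr}})) p≢2

module CyclicGroupRing (q : ℕ) where

  open import Data.Nat.Base as ℕ using (ℕ; zero; suc; _%_; _∸_; _≤_)
  import Data.Nat.Properties as ℕ
  open import Data.Nat.DivMod
    using (_mod_; %-distribˡ-+; %-distribˡ-*; m%n%n≡m%n; m%n<n; m*n%n≡0; m<n⇒m%n≡m; n%n≡0; %-remove-+ˡ)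
  open import Data.Nat.Primality using (Prime)
  open import Data.Fin using (_≟_)
  open import Data.Fin.Base using (Fin; zero; suc; toℕ)
  open import Data.Fin.Properties using (toℕ-fromℕ<; toℕ-injective; toℕ<n)
  open import Data.Integer.Base as ℤ using (ℤ; +_; 0ℤ; 1ℤ; _+_; _*_; -_)
  import Data.Integer.Properties as ℤ
  open import Data.Integer.Solver using (module +-*-Solver)
  open import Data.List.Base using (List; []; _∷_; map; tabulate; allFin)
  open import Data.List.Properties using (map-tabulate; map-cong)
  open import Data.Bool.Base using (if_then_else_)
  open import Data.Product.Base using (Σ; _×_; _,_; proj₁)
  open import Function.Base using (id; _∘_)
  open import Function.Bundles using (mk⇔)
  open import Relation.Nullary.Decidable using (does; does-⇔)
  open import Relation.Binary.PropositionalEquality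
  open import Relation.Binary.Bundles using (Setoid)
  import Relation.Binary.Reasoning.Setoid
  open import Level using (0ℓ)
  open import Algebra.Properties.CommutativeSemigroup ℤ.+-commutativeSemigroup using (interchange)
  import Algebra.Properties.CommutativeSemigroup ℕ.+-commutativeSemigroup as ℕ-+
  open +-*-Solver using (solve; _:+_; _:*_; _:=_; con)

  open Fermat using (fermat₂)

  infixl 6 _+ᴾ_
  _+ᴾ_ : List ℤ → List ℤ → List ℤ
  []       +ᴾ ds       = ds
  (c ∷ cs) +ᴾ []       = c ∷ cs
  (c ∷ cs) +ᴾ (d ∷ ds) = c + d ∷ cs +ᴾ ds

  sumℤ-zeros : ∀ n → sumℤ (tabulate {n = n} (λ _ → + 0)) ≡ + 0
  sumℤ-zeros zero    = refl
  sumℤ-zeros (suc n) = cong (_+_ 0ℤ) (sumℤ-zeros n)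

  sumℤ-δ : ∀ {n} (r : Fin n) (f : Fin n → ℤ) →
           sumℤ (tabulate (λ i → (if does (i ≟ r) then + 1 else + 0) * f i)) ≡ f r
  sumℤ-δ {suc n} zero    f = begin
    + 1 * f zero + sumℤ (tabulate {n = n} (λ _ → + 0)) ≡⟨ cong₂ _+_ (ℤ.*-identityˡ (f zero)) (sumℤ-zeros n) ⟩
    f zero + + 0                                        ≡⟨ ℤ.+-identityʳ (f zero) ⟩
    f zero                                              ∎
    where open ≡-Reasoning
  sumℤ-δ {suc n} (suc r) f = trans (ℤ.+-identityˡ _) (sumℤ-δ r (f ∘ suc))

  sumℤ-map-+ : ∀ {A : Set} (f g : A → ℤ) (xs : List A) →
               sumℤ (map (λ x → f x + g x) xs) ≡ sumℤ (map f xs) + sumℤ (map g xs)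
  sumℤ-map-+ f g []       = refl
  sumℤ-map-+ f g (x ∷ xs) = trans (cong (_+_ (f x + g x)) (sumℤ-map-+ f g xs)) (interchange (f x) (g x) _ _)

  p : ℕ
  p = suc q

  -- Arithmetic modulo p

  -- A record rather than m % p ≡ n % p, so that m and n can be inferred.
  infix 4 _≡ₚ_
  record _≡ₚ_ (m n : ℕ) : Set where
    constructor mk≡ₚ
    field %-≡ : m % p ≡ n % p

  ≡⇒≡ₚ : ∀ {m n} → m ≡ n → m ≡ₚ n
  ≡⇒≡ₚ m≡n = mk≡ₚ (cong (_% p) m≡n)

  ≡ₚ-refl : ∀ {m} → m ≡ₚ m
  ≡ₚ-refl = mk≡ₚ refl

  ≡ₚ-sym : ∀ {m n} → m ≡ₚ n → n ≡ₚ m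
  ≡ₚ-sym (mk≡ₚ eq) = mk≡ₚ (sym eq)

  ≡ₚ-trans : ∀ {m n o} → m ≡ₚ n → n ≡ₚ o → m ≡ₚ o
  ≡ₚ-trans (mk≡ₚ eq) (mk≡ₚ eq′) = mk≡ₚ (trans eq eq′)

  ≡ₚ-setoid : Setoid 0ℓ 0ℓ
  ≡ₚ-setoid = record
    { Carrier       = ℕ
    ; _≈_           = _≡ₚ_
    ; isEquivalence = record { refl = ≡ₚ-refl ; sym = ≡ₚ-sym ; trans = ≡ₚ-trans }
    }

  module ≡ₚ-Reasoning = Relation.Binary.Reasoning.Setoid ≡ₚ-setoid

  +-congₚ : ∀ {a a′ b b′} → a ≡ₚ a′ → b ≡ₚ b′ → a ℕ.+ b ≡ₚ a′ ℕ.+ b′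
  +-congₚ {a} {a′} {b} {b′} (mk≡ₚ a≡a′) (mk≡ₚ b≡b′) = mk≡ₚ (begin
    (a ℕ.+ b) % p           ≡⟨ %-distribˡ-+ a b p ⟩
    (a % p ℕ.+ b % p) % p   ≡⟨ cong₂ (λ x y → (x ℕ.+ y) % p) a≡a′ b≡b′ ⟩
    (a′ % p ℕ.+ b′ % p) % p ≡⟨ %-distribˡ-+ a′ b′ p ⟨
    (a′ ℕ.+ b′) % p         ∎)
    where open ≡-Reasoning

  *-congₚ : ∀ {a a′ b b′} → a ≡ₚ a′ → b ≡ₚ b′ → a ℕ.* b ≡ₚ a′ ℕ.* b′
  *-congₚ {a} {a′} {b} {b′} (mk≡ₚ a≡a′) (mk≡ₚ b≡b′) = mk≡ₚ (begin
    (a ℕ.* b) % p               ≡⟨ %-distribˡ-* a b p ⟩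
    ((a % p) ℕ.* (b % p)) % p   ≡⟨ cong₂ (λ x y → (x ℕ.* y) % p) a≡a′ b≡b′ ⟩
    ((a′ % p) ℕ.* (b′ % p)) % p ≡⟨ %-distribˡ-* a′ b′ p ⟨
    (a′ ℕ.* b′) % p             ∎)
    where open ≡-Reasoning

  -- q is -1 modulo p, so q * c serves as the negative of c.
  +-inverseʳₚ : ∀ c → c ℕ.+ q ℕ.* c ≡ₚ 0
  +-inverseʳₚ c = mk≡ₚ (trans (cong (_% p) (ℕ.*-comm p c)) (m*n%n≡0 c p))

  +-inverseˡₚ : ∀ c → q ℕ.* c ℕ.+ c ≡ₚ 0
  +-inverseˡₚ c = ≡ₚ-trans (≡⇒≡ₚ (ℕ.+-comm (q ℕ.* c) c)) (+-inverseʳₚ c)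

  inverse-uniqueₚ : ∀ x {y z} → x ℕ.+ y ≡ₚ 0 → x ℕ.+ z ≡ₚ 0 → y ≡ₚ z
  inverse-uniqueₚ x {y} {z} x+y≡0 x+z≡0 = begin
    y                 ≡⟨ ℕ.+-identityʳ y ⟨
    y ℕ.+ 0           ≈⟨ +-congₚ (≡ₚ-refl {y}) (≡ₚ-sym x+z≡0) ⟩
    y ℕ.+ (x ℕ.+ z)   ≡⟨ trans (sym (ℕ.+-assoc y x z)) (cong (ℕ._+ z) (ℕ.+-comm y x)) ⟩
    x ℕ.+ y ℕ.+ z     ≈⟨ +-congₚ x+y≡0 ≡ₚ-refl ⟩
    z                 ∎
    where open ≡ₚ-Reasoning

  d+a≡b⇒−a+b≡d : ∀ {a b d} → d ℕ.+ a ≡ₚ b → q ℕ.* a ℕ.+ b ≡ₚ d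
  d+a≡b⇒−a+b≡d {a} {b} {d} d+a≡b = begin
    q ℕ.* a ℕ.+ b          ≈⟨ +-congₚ (≡ₚ-refl {q ℕ.* a}) (≡ₚ-sym d+a≡b) ⟩
    q ℕ.* a ℕ.+ (d ℕ.+ a)  ≡⟨ ℕ-+.x∙yz≈y∙xz (q ℕ.* a) d a ⟩
    d ℕ.+ (q ℕ.* a ℕ.+ a)  ≈⟨ +-congₚ (≡ₚ-refl {d}) (+-inverseˡₚ a) ⟩
    d ℕ.+ 0                ≡⟨ ℕ.+-identityʳ d ⟩
    d                      ∎
    where open ≡ₚ-Reasoning

  d+a≡b⇒a−b≡−d : ∀ {a b d} → d ℕ.+ a ≡ₚ b → a ℕ.+ q ℕ.* b ≡ₚ q ℕ.* d
  d+a≡b⇒a−b≡−d {a} {b} {d} d+a≡b = inverse-uniqueₚ d (begin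
    d ℕ.+ (a ℕ.+ q ℕ.* b)  ≡⟨ ℕ.+-assoc d a (q ℕ.* b) ⟨
    d ℕ.+ a ℕ.+ q ℕ.* b    ≈⟨ +-congₚ d+a≡b (≡ₚ-refl {q ℕ.* b}) ⟩
    b ℕ.+ q ℕ.* b          ≈⟨ +-inverseʳₚ b ⟩
    0                      ∎) (+-inverseʳₚ d)
    where open ≡ₚ-Reasoning

  mod-congₚ : ∀ {m n} → m ≡ₚ n → m mod p ≡ n mod p
  mod-congₚ (mk≡ₚ eq) = toℕ-injective (trans (toℕ-fromℕ< _) (trans eq (sym (toℕ-fromℕ< _))))

  mod-injectiveₚ : ∀ {m n} → m mod p ≡ n mod p → m ≡ₚ n
  mod-injectiveₚ eq = mk≡ₚ (trans (sym (toℕ-fromℕ< _)) (trans (cong toℕ eq) (toℕ-fromℕ< _)))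

  toℕ-modₚ : ∀ n → toℕ (n mod p) ≡ₚ n
  toℕ-modₚ n = mk≡ₚ (trans (cong (_% p) (toℕ-fromℕ< (m%n<n n p))) (m%n%n≡m%n n p))

  toℕ-mod≡id : ∀ (k : Fin p) → toℕ k mod p ≡ k
  toℕ-mod≡id k = toℕ-injective (trans (toℕ-fromℕ< _) (m<n⇒m%n≡m (toℕ<n k)))

  -- Shifts, and multiplication by ζⁿ and θ_c

  V : Set
  V = Cyc p

  shift : ℕ → V → V
  shift a v k = v ((toℕ k ℕ.+ a) mod p)

  shift-cong : ∀ {a b} → a ≡ₚ b → ∀ v → shift a v ≗ shift b v
  shift-cong a≡b v k = cong v (mod-congₚ (+-congₚ (≡ₚ-refl {toℕ k}) a≡b))

  shift-shift : ∀ a b v → shift a (shift b v) ≗ shift (a ℕ.+ b) v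
  shift-shift a b v k = cong v (mod-congₚ (begin
    toℕ ((toℕ k ℕ.+ a) mod p) ℕ.+ b ≈⟨ +-congₚ (toℕ-modₚ (toℕ k ℕ.+ a)) ≡ₚ-refl ⟩
    toℕ k ℕ.+ a ℕ.+ b               ≡⟨ ℕ.+-assoc (toℕ k) a b ⟩
    toℕ k ℕ.+ (a ℕ.+ b)             ∎))
    where open ≡ₚ-Reasoning

  shift-zero : ∀ {a} → a ≡ₚ 0 → ∀ v → shift a v ≗ v
  shift-zero a≡0 v k = trans (shift-cong a≡0 v k)
    (cong v (trans (cong (_mod p) (ℕ.+-identityʳ (toℕ k))) (toℕ-mod≡id k)))

  mod-inverseₚ : ∀ n → n ℕ.+ (p ∸ toℕ (n mod p)) ≡ₚ 0
  mod-inverseₚ n = begin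
    n ℕ.+ (p ∸ toℕ (n mod p))              ≈⟨ +-congₚ (≡ₚ-sym (toℕ-modₚ n)) ≡ₚ-refl ⟩
    toℕ (n mod p) ℕ.+ (p ∸ toℕ (n mod p))  ≡⟨ ℕ.m+[n∸m]≡n (ℕ.<⇒≤ (toℕ<n (n mod p))) ⟩
    p                                      ≈⟨ mk≡ₚ (n%n≡0 p) ⟩
    0                                      ∎
    where open ≡ₚ-Reasoning

  ζ^-⊛ : ∀ n v → ζ^ p n ⊛ v ≗ shift (p ∸ toℕ (n mod p)) v
  ζ^-⊛ n v k = trans (cong sumℤ (map-tabulate id (λ i → ζ^ p n i * ζ⁻ⁱv i))) (sumℤ-δ (n mod p) ζ⁻ⁱv)
    where
    ζ⁻ⁱv : Fin p → ℤ
    ζ⁻ⁱv i = shift (p ∸ toℕ i) v k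

  ⊛-distribʳ-⊕ : ∀ a b v → (a ⊕ b) ⊛ v ≗ (a ⊛ v) ⊕ (b ⊛ v)
  ⊛-distribʳ-⊕ a b v k = trans (cong sumℤ (map-cong (λ i → ℤ.*-distribʳ-+ (ζ⁻ⁱv i) (a i) (b i)) (allFin p)))
                                (sumℤ-map-+ (λ i → a i * ζ⁻ⁱv i) (λ i → b i * ζ⁻ⁱv i) (allFin p))
    where
    ζ⁻ⁱv : Fin p → ℤ
    ζ⁻ⁱv i = shift (p ∸ toℕ i) v k

  -- Unlike θ p c, which relies on the truncated p ∸ c, this is multiplication by θ_c for every c.
  mulθ : ℕ → V → V
  mulθ c v = shift c v ⊕ shift (q ℕ.* c) v

  θ-⊛ : ∀ {j} → j ℕ.≤ p → ∀ v → θ p j ⊛ v ≗ mulθ j v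
  θ-⊛ {j} j≤p v k = begin
    (θ p j ⊛ v) k                                          ≡⟨ ⊛-distribʳ-⊕ (ζ^ p j) (ζ^ p (p ∸ j)) v k ⟩
    (ζ^ p j ⊛ v) k + (ζ^ p (p ∸ j) ⊛ v) k                  ≡⟨ cong₂ _+_ (ζ^-⊛ j v k) (ζ^-⊛ (p ∸ j) v k) ⟩
    shift (p ∸ toℕ (j mod p)) v k + shift (p ∸ toℕ ((p ∸ j) mod p)) v k
      ≡⟨ cong₂ _+_ (shift-cong (inverse-uniqueₚ j (mod-inverseₚ j) (+-inverseʳₚ j)) v k)
                   (shift-cong (inverse-uniqueₚ (p ∸ j) (mod-inverseₚ (p ∸ j)) p∸j+j≡0) v k) ⟩
    shift (q ℕ.* j) v k + shift j v k                       ≡⟨ ℤ.+-comm (shift (q ℕ.* j) v k) (shift j v k) ⟩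
    mulθ j v k                                              ∎
    where
    open ≡-Reasoning
    p∸j+j≡0 : p ∸ j ℕ.+ j ≡ₚ 0
    p∸j+j≡0 = ≡ₚ-trans (≡⇒≡ₚ (ℕ.m∸n+n≡m j≤p)) (mk≡ₚ (n%n≡0 p))

  shift-one : ∀ {a b} → a ℕ.+ b ≡ₚ 0 → shift a (oneᶜ p) ≗ ζ^ p b
  shift-one {a} {b} a+b≡0 k =
    cong (if_then + 1 else + 0) (does-⇔ (mk⇔ to from) ((toℕ k ℕ.+ a) mod p ≟ 0 mod p) (k ≟ b mod p))
    where
    to : (toℕ k ℕ.+ a) mod p ≡ 0 mod p → k ≡ b mod p
    to eq = trans (sym (toℕ-mod≡id k)) (mod-congₚ (inverse-uniqueₚ a
              (≡ₚ-trans (≡⇒≡ₚ (ℕ.+-comm a (toℕ k))) (mod-injectiveₚ eq)) a+b≡0))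
    from : k ≡ b mod p → (toℕ k ℕ.+ a) mod p ≡ 0 mod p
    from eq = mod-congₚ (begin
      toℕ k ℕ.+ a            ≡⟨ cong (λ i → toℕ i ℕ.+ a) eq ⟩
      toℕ (b mod p) ℕ.+ a    ≈⟨ +-congₚ (toℕ-modₚ b) ≡ₚ-refl ⟩
      b ℕ.+ a                ≡⟨ ℕ.+-comm b a ⟩
      a ℕ.+ b                ≈⟨ a+b≡0 ⟩
      0                      ∎)
      where open ≡ₚ-Reasoning

  mulθ-one : ∀ {j} → j ℕ.≤ p → mulθ j (oneᶜ p) ≗ θ p j
  mulθ-one {j} j≤p k = trans (cong₂ _+_ (shift-one (≡ₚ-trans (≡⇒≡ₚ (ℕ.m+[n∸m]≡n j≤p)) (mk≡ₚ (n%n≡0 p))) k)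
                                        (shift-one (+-inverseˡₚ j) k))
                             (ℤ.+-comm (ζ^ p (p ∸ j) k) (ζ^ p j k))

  mulθ-resp : ∀ c {v w} → v ≗ w → mulθ c v ≗ mulθ c w
  mulθ-resp c v≗w k = cong₂ _+_ (v≗w _) (v≗w _)

  mulθ-⊕ : ∀ c v w → mulθ c (v ⊕ w) ≗ mulθ c v ⊕ mulθ c w
  mulθ-⊕ c v w k = interchange (shift c v k) (shift c w k) (shift (q ℕ.* c) v k) (shift (q ℕ.* c) w k)

  mulθ-scale : ∀ c a v → mulθ c (scale a v) ≗ scale a (mulθ c v)
  mulθ-scale c a v k = sym (ℤ.*-distribˡ-+ a (shift c v k) (shift (q ℕ.* c) v k))

  mulθ-cong : ∀ {a b} → a ≡ₚ b → ∀ v → mulθ a v ≗ mulθ b v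
  mulθ-cong a≡b v k = cong₂ _+_ (shift-cong a≡b v k) (shift-cong (*-congₚ (≡ₚ-refl {q}) a≡b) v k)

  shift-comm : ∀ a b v → shift a (shift b v) ≗ shift b (shift a v)
  shift-comm a b v k = trans (shift-shift a b v k)
                      (trans (cong (λ c → shift c v k) (ℕ.+-comm a b)) (sym (shift-shift b a v k)))

  mulθ-comm : ∀ a b v → mulθ a (mulθ b v) ≗ mulθ b (mulθ a v)
  mulθ-comm a b v k = trans
    (cong₂ _+_ (cong₂ _+_ (shift-comm a b v k) (shift-comm a (q ℕ.* b) v k))
               (cong₂ _+_ (shift-comm (q ℕ.* a) b v k) (shift-comm (q ℕ.* a) (q ℕ.* b) v k)))
    (interchange (shift b (shift a v) k) (shift (q ℕ.* b) (shift a v) k)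
                 (shift b (shift (q ℕ.* a) v) k) (shift (q ℕ.* b) (shift (q ℕ.* a) v) k))

  mulθ-mulθ : ∀ {a b d} → d ℕ.+ a ≡ₚ b → ∀ v → mulθ a (mulθ b v) ≗ mulθ (a ℕ.+ b) v ⊕ mulθ d v
  mulθ-mulθ {a} {b} {d} d+a≡b v k = begin
    (shift a (shift b v) k + shift a (shift (q ℕ.* b) v) k) +
    (shift (q ℕ.* a) (shift b v) k + shift (q ℕ.* a) (shift (q ℕ.* b) v) k)
      ≡⟨ cong₂ _+_
           (cong₂ _+_ (shift-shift a b v k)
                      (trans (shift-shift a (q ℕ.* b) v k) (shift-cong (d+a≡b⇒a−b≡−d d+a≡b) v k)))
           (cong₂ _+_ (trans (shift-shift (q ℕ.* a) b v k) (shift-cong (d+a≡b⇒−a+b≡d d+a≡b) v k))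
                      (trans (shift-shift (q ℕ.* a) (q ℕ.* b) v k)
                             (cong (λ c → shift c v k) (sym (ℕ.*-distribˡ-+ q a b))))) ⟩
    (shift (a ℕ.+ b) v k + shift (q ℕ.* d) v k) + (shift d v k + shift (q ℕ.* (a ℕ.+ b)) v k)
      ≡⟨ solve 4 (λ A B C D → (A :+ B) :+ (C :+ D) := (A :+ D) :+ (C :+ B)) refl
           (shift (a ℕ.+ b) v k) (shift (q ℕ.* d) v k) (shift d v k) (shift (q ℕ.* (a ℕ.+ b)) v k) ⟩
    (mulθ (a ℕ.+ b) v ⊕ mulθ d v) k
      ∎
    where open ≡-Reasoning

  mulθ-zero : ∀ v → mulθ 0 v ≗ scale (+ 2) v
  mulθ-zero v k = trans (cong₂ _+_ (shift-zero ≡ₚ-refl v k) (shift-zero (≡⇒≡ₚ (ℕ.*-zeroʳ q)) v k))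
                        (solve 1 (λ x → x :+ x := con (+ 2) :* x) refl (v k))

  mulθ-square : ∀ c v → mulθ c (mulθ c v) ≗ mulθ (c ℕ.+ c) v ⊕ scale (+ 2) v
  mulθ-square c v k = trans (mulθ-mulθ ≡ₚ-refl v k) (cong (_+_ (mulθ (c ℕ.+ c) v k)) (mulθ-zero v k))

  mulθ-chebyshev : ∀ n v → mulθ (2 ℕ.+ n) v ≗ mulθ 1 (mulθ (suc n) v) ⊕ scale (- 1ℤ) (mulθ n v)
  mulθ-chebyshev n v k = begin
    mulθ (2 ℕ.+ n) v k
      ≡⟨ solve 2 (λ x y → x := (x :+ y) :+ con (- 1ℤ) :* y) refl _ _ ⟩
    mulθ (2 ℕ.+ n) v k + mulθ n v k + - 1ℤ * mulθ n v k
      ≡⟨ cong (_+ - 1ℤ * mulθ n v k) (mulθ-mulθ (≡⇒≡ₚ (ℕ.+-comm n 1)) v k) ⟨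
    mulθ 1 (mulθ (suc n) v) k + - 1ℤ * mulθ n v k
      ∎
    where open ≡-Reasoning

  -- The order 𝒪 = ℤ[θ₁]

  θ₁ : V
  θ₁ = θ p 1

  infix 4 _∈𝒪
  _∈𝒪 : V → Set
  v ∈𝒪 = Σ (List ℤ) λ cs → v ≗ evalPoly p cs θ₁

  evalPoly-∷ : ∀ c cs → evalPoly p (c ∷ cs) θ₁ ≗ scale c (oneᶜ p) ⊕ mulθ 1 (evalPoly p cs θ₁)
  evalPoly-∷ c cs k = cong (_+_ (c * oneᶜ p k)) (θ-⊛ (ℕ.s≤s ℕ.z≤n) (evalPoly p cs θ₁) k)

  evalPoly-+ᴾ : ∀ cs ds → evalPoly p (cs +ᴾ ds) θ₁ ≗ evalPoly p cs θ₁ ⊕ evalPoly p ds θ₁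
  evalPoly-+ᴾ []       ds       k = sym (ℤ.+-identityˡ _)
  evalPoly-+ᴾ (c ∷ cs) []       k = sym (ℤ.+-identityʳ _)
  evalPoly-+ᴾ (c ∷ cs) (d ∷ ds) k = begin
    evalPoly p ((c + d) ∷ (cs +ᴾ ds)) θ₁ k     ≡⟨ evalPoly-∷ (c + d) (cs +ᴾ ds) k ⟩
    (c + d) * e + mulθ 1 (evalPoly p (cs +ᴾ ds) θ₁) k
      ≡⟨ cong₂ _+_ (ℤ.*-distribʳ-+ e c d)
                   (trans (mulθ-resp 1 (evalPoly-+ᴾ cs ds) k) (mulθ-⊕ 1 (evalPoly p cs θ₁) (evalPoly p ds θ₁) k)) ⟩
    (c * e + d * e) + (f + g)                   ≡⟨ interchange (c * e) (d * e) f g ⟩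
    (c * e + f) + (d * e + g)                   ≡⟨ cong₂ _+_ (evalPoly-∷ c cs k) (evalPoly-∷ d ds k) ⟨
    evalPoly p (c ∷ cs) θ₁ k + evalPoly p (d ∷ ds) θ₁ k ∎
    where
    open ≡-Reasoning
    e f g : ℤ
    e = oneᶜ p k
    f = mulθ 1 (evalPoly p cs θ₁) k
    g = mulθ 1 (evalPoly p ds θ₁) k

  evalPoly-scale : ∀ a cs → evalPoly p (map (a *_) cs) θ₁ ≗ scale a (evalPoly p cs θ₁)
  evalPoly-scale a []       k = sym (ℤ.*-zeroʳ a)
  evalPoly-scale a (c ∷ cs) k = begin
    evalPoly p (a * c ∷ map (a *_) cs) θ₁ k
      ≡⟨ evalPoly-∷ (a * c) (map (a *_) cs) k ⟩
    a * c * oneᶜ p k + mulθ 1 (evalPoly p (map (a *_) cs) θ₁) k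
      ≡⟨ cong₂ _+_ (ℤ.*-assoc a c (oneᶜ p k))
                   (trans (mulθ-resp 1 (evalPoly-scale a cs) k) (mulθ-scale 1 a (evalPoly p cs θ₁) k)) ⟩
    a * (c * oneᶜ p k) + a * mulθ 1 (evalPoly p cs θ₁) k
      ≡⟨ ℤ.*-distribˡ-+ a _ _ ⟨
    a * (c * oneᶜ p k + mulθ 1 (evalPoly p cs θ₁) k)
      ≡⟨ cong (a *_) (evalPoly-∷ c cs k) ⟨
    a * evalPoly p (c ∷ cs) θ₁ k
      ∎
    where open ≡-Reasoning

  ∈𝒪-resp : ∀ {v w} → v ≗ w → w ∈𝒪 → v ∈𝒪
  ∈𝒪-resp v≗w (cs , w≗) = cs , λ k → trans (v≗w k) (w≗ k)

  zero∈𝒪 : zeroᶜ ∈𝒪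
  zero∈𝒪 = [] , λ _ → refl

  one∈𝒪 : oneᶜ p ∈𝒪
  one∈𝒪 = 1ℤ ∷ [] , λ k → sym (trans (evalPoly-∷ 1ℤ [] k) (trans (ℤ.+-identityʳ _) (ℤ.*-identityˡ _)))

  ⊕∈𝒪 : ∀ {v w} → v ∈𝒪 → w ∈𝒪 → v ⊕ w ∈𝒪
  ⊕∈𝒪 (cs , v≗) (ds , w≗) = cs +ᴾ ds , λ k → trans (cong₂ _+_ (v≗ k) (w≗ k)) (sym (evalPoly-+ᴾ cs ds k))

  scale∈𝒪 : ∀ a {v} → v ∈𝒪 → scale a v ∈𝒪
  scale∈𝒪 a (cs , v≗) = map (a *_) cs , λ k → trans (cong (a *_) (v≗ k)) (sym (evalPoly-scale a cs k))

  mulθ₁∈𝒪 : ∀ {v} → v ∈𝒪 → mulθ 1 v ∈𝒪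
  mulθ₁∈𝒪 (cs , v≗) = 0ℤ ∷ cs , λ k →
    trans (mulθ-resp 1 v≗ k) (sym (trans (evalPoly-∷ 0ℤ cs k) (ℤ.+-identityˡ _)))

  θₙ,θₙ₊₁∈𝒪 : ∀ n → mulθ n (oneᶜ p) ∈𝒪 × mulθ (suc n) (oneᶜ p) ∈𝒪
  θₙ,θₙ₊₁∈𝒪 zero    = ∈𝒪-resp (mulθ-zero (oneᶜ p)) (scale∈𝒪 (+ 2) one∈𝒪) , mulθ₁∈𝒪 one∈𝒪
  θₙ,θₙ₊₁∈𝒪 (suc n) with θₙ,θₙ₊₁∈𝒪 n
  ... | θₙ∈𝒪 , θₙ₊₁∈𝒪 = θₙ₊₁∈𝒪 , ∈𝒪-resp (mulθ-chebyshev n (oneᶜ p)) (⊕∈𝒪 (mulθ₁∈𝒪 θₙ₊₁∈𝒪) (scale∈𝒪 (- 1ℤ) θₙ∈𝒪))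

  θ∈𝒪 : ∀ c → mulθ c (oneᶜ p) ∈𝒪
  θ∈𝒪 c = proj₁ (θₙ,θₙ₊₁∈𝒪 c)

  mulθ-evalPoly∈𝒪 : ∀ c cs → mulθ c (evalPoly p cs θ₁) ∈𝒪
  mulθ-evalPoly∈𝒪 c []       = zero∈𝒪
  mulθ-evalPoly∈𝒪 c (d ∷ cs) = ∈𝒪-resp
    (λ k → trans (mulθ-resp c (evalPoly-∷ d cs) k)
           (trans (mulθ-⊕ c (scale d (oneᶜ p)) (mulθ 1 f) k)
                  (cong₂ _+_ (mulθ-scale c d (oneᶜ p) k) (mulθ-comm c 1 f k))))
    (⊕∈𝒪 (scale∈𝒪 d (θ∈𝒪 c)) (mulθ₁∈𝒪 (mulθ-evalPoly∈𝒪 c cs)))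
    where
    f : V
    f = evalPoly p cs θ₁

  mulθ∈𝒪 : ∀ c {v} → v ∈𝒪 → mulθ c v ∈𝒪
  mulθ∈𝒪 c (cs , v≗) = ∈𝒪-resp (mulθ-resp c v≗) (mulθ-evalPoly∈𝒪 c cs)

  -- Squaring modulo 4𝒪

  mulθ^ : ℕ → ℕ → V → V
  mulθ^ j zero    v = v
  mulθ^ j (suc n) v = mulθ j (mulθ^ j n v)

  mulθ^-resp : ∀ j n {v w} → v ≗ w → mulθ^ j n v ≗ mulθ^ j n w
  mulθ^-resp j zero    v≗w = v≗w
  mulθ^-resp j (suc n) v≗w = mulθ-resp j (mulθ^-resp j n v≗w)

  mulθ^-⊕ : ∀ j n v w → mulθ^ j n (v ⊕ w) ≗ mulθ^ j n v ⊕ mulθ^ j n w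
  mulθ^-⊕ j zero    v w k = refl
  mulθ^-⊕ j (suc n) v w k = trans (mulθ-resp j (mulθ^-⊕ j n v w) k) (mulθ-⊕ j (mulθ^ j n v) (mulθ^ j n w) k)

  mulθ^-scale : ∀ j n a v → mulθ^ j n (scale a v) ≗ scale a (mulθ^ j n v)
  mulθ^-scale j zero    a v k = refl
  mulθ^-scale j (suc n) a v k = trans (mulθ-resp j (mulθ^-scale j n a v) k) (mulθ-scale j a (mulθ^ j n v) k)

  mulθ^-mulθ : ∀ j n c v → mulθ^ j n (mulθ c v) ≗ mulθ c (mulθ^ j n v)
  mulθ^-mulθ j zero    c v k = refl
  mulθ^-mulθ j (suc n) c v k = trans (mulθ-resp j (mulθ^-mulθ j n c v) k) (mulθ-comm j c (mulθ^ j n v) k)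

  mulθ^-+ : ∀ j m n v → mulθ^ j (m ℕ.+ n) v ≡ mulθ^ j m (mulθ^ j n v)
  mulθ^-+ j zero    n v = refl
  mulθ^-+ j (suc m) n v = cong (mulθ j) (mulθ^-+ j m n v)

  mulθ^∈𝒪 : ∀ j n {v} → v ∈𝒪 → mulθ^ j n v ∈𝒪
  mulθ^∈𝒪 j zero    v∈𝒪 = v∈𝒪
  mulθ^∈𝒪 j (suc n) v∈𝒪 = mulθ∈𝒪 j (mulθ^∈𝒪 j n v∈𝒪)

  ^ᶜ-mulθ^ : ∀ {j} → j ℕ.≤ p → ∀ n → _^ᶜ_ p (θ p j) n ≗ mulθ^ j n (oneᶜ p)
  ^ᶜ-mulθ^ j≤p zero    k = refl
  ^ᶜ-mulθ^ {j} j≤p (suc n) k = trans (θ-⊛ j≤p (_^ᶜ_ p (θ p j) n) k) (mulθ-resp j (^ᶜ-mulθ^ j≤p n) k)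

  infix 4 _≡_[mod4𝒪]
  _≡_[mod4𝒪] : V → V → Set
  v ≡ w [mod4𝒪] = Σ V λ h → h ∈𝒪 × v ≗ w ⊕ scale (+ 4) h

  θ+2 : ℕ → V
  θ+2 c = mulθ c (oneᶜ p) ⊕ scale (+ 2) (oneᶜ p)

  mulθ-⊕-scale : ∀ c v a w → mulθ c (v ⊕ scale a w) ≗ mulθ c v ⊕ scale a (mulθ c w)
  mulθ-⊕-scale c v a w k = trans (mulθ-⊕ c v (scale a w) k) (cong (_+_ (mulθ c v k)) (mulθ-scale c a w k))

  mulθ^-⊕-scale : ∀ j n v a w → mulθ^ j n (v ⊕ scale a w) ≗ mulθ^ j n v ⊕ scale a (mulθ^ j n w)
  mulθ^-⊕-scale j n v a w k = trans (mulθ^-⊕ j n v (scale a w) k) (cong (_+_ (mulθ^ j n v k)) (mulθ^-scale j n a w k))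

  square-step : ∀ {j n c} → mulθ^ j n (oneᶜ p) ≡ θ+2 c [mod4𝒪] →
                mulθ^ j (n ℕ.+ n) (oneᶜ p) ≡ θ+2 (c ℕ.+ c) [mod4𝒪]
  square-step {j} {n} {c} (h , h∈𝒪 , U1≗) = h′ , h′∈𝒪 , U²1≗
    where
    e : V
    e = oneᶜ p
    U : V → V
    U = mulθ^ j n
    -- U (U e) = U (θ_c + 2 + 4h) = θ_c (U e) + 2 U e + 4 U h, expanded once more via U e ≗ θ_c + 2 + 4h.
    h′ : V
    h′ = (mulθ c e ⊕ e) ⊕ (mulθ c h ⊕ (scale (+ 2) h ⊕ U h))
    h′∈𝒪 : h′ ∈𝒪
    h′∈𝒪 = ⊕∈𝒪 (⊕∈𝒪 (θ∈𝒪 c) one∈𝒪) (⊕∈𝒪 (mulθ∈𝒪 c h∈𝒪) (⊕∈𝒪 (scale∈𝒪 (+ 2) h∈𝒪) (mulθ^∈𝒪 j n h∈𝒪)))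
    U²1≗ : mulθ^ j (n ℕ.+ n) e ≗ θ+2 (c ℕ.+ c) ⊕ scale (+ 4) h′
    U²1≗ k = begin
      mulθ^ j (n ℕ.+ n) e k                      ≡⟨ cong-app (mulθ^-+ j n n e) k ⟩
      U (U e) k                                  ≡⟨ mulθ^-resp j n U1≗ k ⟩
      U (θ+2 c ⊕ scale (+ 4) h) k                ≡⟨ mulθ^-⊕-scale j n (θ+2 c) (+ 4) h k ⟩
      U (θ+2 c) k + + 4 * Z
        ≡⟨ cong (_+ + 4 * Z) (trans (mulθ^-⊕-scale j n (mulθ c e) (+ 2) e k)
                                    (cong (_+ + 2 * U e k) (mulθ^-mulθ j n c e k))) ⟩
      (mulθ c (U e) k + + 2 * U e k) + + 4 * Z
        ≡⟨ cong₂ (λ x y → (x + + 2 * y) + + 4 * Z) θc·Ue (U1≗ k) ⟩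
      ((((T₂ + + 2 * E) + + 2 * T) + + 4 * X) + + 2 * ((T + + 2 * E) + + 4 * Y)) + + 4 * Z
        ≡⟨ solve 6 (λ T₂ E T X Y Z →
             ((((T₂ :+ con (+ 2) :* E) :+ con (+ 2) :* T) :+ con (+ 4) :* X)
               :+ con (+ 2) :* ((T :+ con (+ 2) :* E) :+ con (+ 4) :* Y)) :+ con (+ 4) :* Z
             := (T₂ :+ con (+ 2) :* E) :+ con (+ 4) :* ((T :+ E) :+ (X :+ (con (+ 2) :* Y :+ Z))))
             refl T₂ E T X Y Z ⟩
      (θ+2 (c ℕ.+ c) ⊕ scale (+ 4) h′) k          ∎
      where
      open ≡-Reasoning
      T₂ E T X Y Z : ℤ
      T₂ = mulθ (c ℕ.+ c) e k
      E  = e k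
      T  = mulθ c e k
      X  = mulθ c h k
      Y  = h k
      Z  = U h k
      θc·Ue : mulθ c (U e) k ≡ ((T₂ + + 2 * E) + + 2 * T) + + 4 * X
      θc·Ue = begin
        mulθ c (U e) k                                ≡⟨ mulθ-resp c U1≗ k ⟩
        mulθ c (θ+2 c ⊕ scale (+ 4) h) k              ≡⟨ mulθ-⊕-scale c (θ+2 c) (+ 4) h k ⟩
        mulθ c (θ+2 c) k + + 4 * X                    ≡⟨ cong (_+ + 4 * X) (mulθ-⊕-scale c (mulθ c e) (+ 2) e k) ⟩
        (mulθ c (mulθ c e) k + + 2 * T) + + 4 * X     ≡⟨ cong (λ x → (x + + 2 * T) + + 4 * X) (mulθ-square c e k) ⟩
        ((T₂ + + 2 * E) + + 2 * T) + + 4 * X          ∎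

  θⱼ^2^[1+k]≡θ+2 : ∀ j k → mulθ^ j (2 ℕ.^ suc k) (oneᶜ p) ≡ θ+2 (2 ℕ.^ suc k ℕ.* j) [mod4𝒪]
  θⱼ^2^[1+k]≡θ+2 j zero    = zeroᶜ , zero∈𝒪 , λ k → begin
    mulθ j (mulθ j (oneᶜ p)) k                               ≡⟨ mulθ-square j (oneᶜ p) k ⟩
    mulθ (j ℕ.+ j) (oneᶜ p) k + + 2 * oneᶜ p k
      ≡⟨ cong (λ c → mulθ (j ℕ.+ c) (oneᶜ p) k + + 2 * oneᶜ p k) (ℕ.+-identityʳ j) ⟨
    θ+2 (2 ℕ.* j) k                                          ≡⟨ ℤ.+-identityʳ _ ⟨
    (θ+2 (2 ℕ.* j) ⊕ scale (+ 4) zeroᶜ) k                    ∎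
    where open ≡-Reasoning
  θⱼ^2^[1+k]≡θ+2 j (suc k) =
    subst₂ (λ m c → mulθ^ j m (oneᶜ p) ≡ θ+2 c [mod4𝒪]) n+n≡2n c+c≡2nj (square-step {j} {n} (θⱼ^2^[1+k]≡θ+2 j k))
    where
    n : ℕ
    n = 2 ℕ.^ suc k
    n+n≡2n : n ℕ.+ n ≡ 2 ℕ.* n
    n+n≡2n = cong (n ℕ.+_) (sym (ℕ.+-identityʳ n))
    c+c≡2nj : n ℕ.* j ℕ.+ n ℕ.* j ≡ 2 ℕ.* n ℕ.* j
    c+c≡2nj = trans (sym (ℕ.*-distribʳ-+ j n n)) (cong (ℕ._* j) n+n≡2n)

  ^-congₚ : ∀ {a b} → a ≡ₚ b → ∀ m → a ℕ.^ m ≡ₚ b ℕ.^ m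
  ^-congₚ a≡b zero    = ≡ₚ-refl
  ^-congₚ a≡b (suc m) = *-congₚ a≡b (^-congₚ a≡b m)

  2^[q*m]≡ₚ1 : Prime p → p ≢ 2 → ∀ m → 2 ℕ.^ (q ℕ.* m) ≡ₚ 1
  2^[q*m]≡ₚ1 pr p≢2 m = begin
    2 ℕ.^ (q ℕ.* m)      ≡⟨ ℕ.^-*-assoc 2 q m ⟨
    (2 ℕ.^ q) ℕ.^ m      ≈⟨ ^-congₚ 2^q≡1 m ⟩
    1 ℕ.^ m              ≡⟨ ℕ.^-zeroˡ m ⟩
    1                    ∎
    where
    open ≡ₚ-Reasoning
    2^q≡1 : 2 ℕ.^ q ≡ₚ 1
    2^q≡1 = mk≡ₚ (trans (cong (_% p) (sym (ℕ.m∸n+n≡m (ℕ.m^n>0 2 q)))) (%-remove-+ˡ 1 (fermat₂ pr p≢2)))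

  θⱼ^2^[1+N]≡θⱼ+2 : ∀ {j} → j ≤ p → ∀ N → 2 ℕ.^ suc N ≡ₚ 1 →
                    _^ᶜ_ p (θ p j) (2 ℕ.^ suc N) ≡ θ p j ⊕ scale (+ 2) (oneᶜ p) [mod4𝒪]
  θⱼ^2^[1+N]≡θⱼ+2 {j} j≤p N 2^N≡1 with θⱼ^2^[1+k]≡θ+2 j N
  ... | h , h∈𝒪 , θⱼ^2^N≗ = h , h∈𝒪 , λ k →
    trans (^ᶜ-mulθ^ j≤p (2 ℕ.^ suc N) k)
    (trans (θⱼ^2^N≗ k)
    (cong (λ x → (x + + 2 * oneᶜ p k) + + 4 * h k) (trans (mulθ-cong 2^Nj≡j (oneᶜ p) k) (mulθ-one j≤p k))))
    where
    2^Nj≡j : 2 ℕ.^ suc N ℕ.* j ≡ₚ j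
    2^Nj≡j = ≡ₚ-trans (*-congₚ 2^N≡1 (≡ₚ-refl {j})) (≡⇒≡ₚ (ℕ.*-identityˡ j))

  ≡[mod4𝒪]⇒CongMod4OK : ∀ {v w} → v ≡ w [mod4𝒪] → CongMod4OK p v w
  ≡[mod4𝒪]⇒CongMod4OK {w = w} (h , (cs , h≗) , v≗) = cs , 0ℤ , λ k →
    trans (v≗ k) (trans (cong (λ x → w k + + 4 * x) (h≗ k)) (sym (ℤ.+-identityʳ _)))

open import Data.Nat using (ℕ; NonZero; _∸_; _*_; _^_; _≤_)
open import Data.Nat.Base using (zero; suc; _+_)
open import Data.Nat.DivMod using (_/_)
open import Data.Nat.Primality using (Prime)
open import Data.Integer using (+_)
open import Relation.Binary.PropositionalEquality using (_≢_)
import Data.Nat.Properties as ℕ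
open import Data.Nat.DivMod using (m/n≤m)

lemma2p4 : (p : ℕ) .{{_ : NonZero p}} → Prime p → p ≢ 2 →
    (m j : ℕ) → 1 ≤ m → 1 ≤ j → j ≤ (p ∸ 1) / 2 →
    CongMod4OK p (_^ᶜ_ p (θ p j) (2 ^ ((p ∸ 1) * m))) (θ p j ⊕ scale (+ 2) (oneᶜ p))
lemma2p4 0 ()
lemma2p4 1 ()
lemma2p4 (suc q) pr p≢2 zero j () _ _
-- Here (p ∸ 1) * suc m reduces to suc (m + q′ * suc m).
lemma2p4 (suc (suc q′)) pr p≢2 (suc m) j _ _ j≤[p-1]/2 =
  ≡[mod4𝒪]⇒CongMod4OK {w = θ p j ⊕ scale (+ 2) (oneᶜ p)}
    (θⱼ^2^[1+N]≡θⱼ+2 j≤p (m + q′ * suc m) (2^[q*m]≡ₚ1 pr p≢2 (suc m)))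
  where
  open CyclicGroupRing (suc q′)
  j≤p : j ≤ p
  j≤p = ℕ.≤-trans j≤[p-1]/2 (ℕ.≤-trans (m/n≤m (suc q′) 2) (ℕ.n≤1+n (suc q′)))
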